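{- Let $\mathcal{X}=\{\mathbf{x}_1,\dots,\mathbf{x}_m\}\subset\mathbb{R}^d$, let $[m]=B\cup R$ be a partition, let $L_B,L_R$ be disjoint finite sets of group indices, and let $M>0$ be a fixed big constant. Let $S=\{i_1,\dots,i_s\}\subseteq B$ be such that $\mathbf{x}_S$ is an obstacle between two points $\mathbf{x}_{j_1},\mathbf{x}_{j_2}$ with $j_1,j_2\in R$, $j_1\ne j_2$. Then for every $k\in L_B$ and $\ell\in L_R$ the obstacle inequality $$z_{j_1\ell}+z_{j_2\ell}+\sum_{i\in S}z_{ik}\le s+1$$ is valid for $P_{\mathcal{I}}$.
   Context: For $S\subseteq[m]$, $\mathbf{x}_S:=\{\mathbf{x}_i:i\in S\}$. Given distinct $\mathbf{y}_1,\mathbf{y}_2\in\mathbb{R}^d$, a set $Y\subseteq\mathbb{R}^d$ is an obstacle between $\mathbf{y}_1$ and $\mathbf{y}_2$ if $\operatorname{conv}(Y)\cap\operatorname{conv}(\{\mathbf{y}_1,\mathbf{y}_2\})\ne\emptyset$. The polyhedron $P_{\mathcal{I}}$ of the instance $\mathcal{I}=(\mathcal{X},B,R,L_B,L_R)$ is the convex hull of all points $(\mathbf{p},q,z)$, where $\mathbf{p}=(\mathbf{p}_{k\ell})_{k\in L_B,\ell\in L_R}$ with $\mathbf{p}_{k\ell}\in\mathbb{R}^d$, $q=(q_{k\ell})$ with $q_{k\ell}\in\mathbb{R}$, and $z=(z_{ik})_{(i,k)\in(B\times L_B)\cup(R\times L_R)}$ with $z_{ik}\in\{0,1\}$, satisfying: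 $\mathbf{p}_{k\ell}\cdot\mathbf{x}_i+q_{k\ell}\le M-(M+1)z_{ik}$ for all $i\in B,k\in L_B,\ell\in L_R$; $\mathbf{p}_{k\ell}\cdot\mathbf{x}_j+q_{k\ell}\ge -M+(M+1)z_{j\ell}$ for all $j\in R,\ell\in L_R,k\in L_B$; $\sum_{k\in L_B}z_{ik}\le 1$ for all $i\in B$; $\sum_{\ell\in L_R}z_{j\ell}\le1$ for all $j\in R$. Here $\cdot$ is the standard inner product. -}

module Defs where

open import Level using (Level; _⊔_) renaming (suc to lsuc)
open import Data.Nat using (ℕ; zero; suc)
open import Data.Fin using (Fin)
open import Data.Bool using (Bool; true; false; if_then_else_)
open import Data.Product using (Σ; _×_; _,_; ∃)
open import Data.Sum using (_⊎_)
open import Data.Fin.Subset using (Subset; _∈_; _∉_; _⊆_; ∣_∣)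
open import Data.Vec using (lookup)
open import Relation.Nullary using (¬_)
open import Relation.Binary.PropositionalEquality using (_≡_)
open import Algebra.Bundles using (CommutativeRing)

-- The reals ℝ (absent from agda-stdlib) are an instance.
record OrderedField (c ℓ₁ ℓ₂ : Level) : Set (lsuc (c ⊔ ℓ₁ ⊔ ℓ₂)) where
  field
    commutativeRing : CommutativeRing c ℓ₁
  open CommutativeRing commutativeRing public
  infix 4 _≤_
  field
    _≤_        : Carrier → Carrier → Set ℓ₂
    ≤-resp-≈   : ∀ {a b c d} → a ≈ b → c ≈ d → a ≤ c → b ≤ d
    ≤-refl     : ∀ {a} → a ≤ a
    ≤-trans    : ∀ {a b c} → a ≤ b → b ≤ c → a ≤ c
    ≤-antisym  : ∀ {a b} → a ≤ b → b ≤ a → a ≈ b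
    ≤-total    : ∀ a b → a ≤ b ⊎ b ≤ a
    +-mono-≤   : ∀ {a b} c → a ≤ b → a + c ≤ b + c
    *-nonneg   : ∀ {a b} → 0# ≤ a → 0# ≤ b → 0# ≤ a * b
    0≉1        : ¬ (0# ≈ 1#)
    inverse    : ∀ a → ¬ (a ≈ 0#) → Σ Carrier (λ b → a * b ≈ 1#)

  _<_ : Carrier → Carrier → Set (ℓ₁ ⊔ ℓ₂)
  a < b = (a ≤ b) × ¬ (a ≈ b)

  sumF : ∀ {n} → (Fin n → Carrier) → Carrier
  sumF {zero}  f = 0#
  sumF {suc n} f = f Fin.zero + sumF (λ i → f (Fin.suc i))

  sumOver : ∀ {n} → Subset n → (Fin n → Carrier) → Carrier
  sumOver S f = sumF (λ i → if lookup S i then f i else 0#)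

  _·_ : ∀ {d} → (Fin d → Carrier) → (Fin d → Carrier) → Carrier
  u · v = sumF (λ t → u t * v t)

  fromℕ : ℕ → Carrier
  fromℕ zero    = 0#
  fromℕ (suc n) = 1# + fromℕ n

  IsBinary : Carrier → Set ℓ₁
  IsBinary a = (a ≈ 0#) ⊎ (a ≈ 1#)

  -- L_B = Fin nB, L_R = Fin nR (disjoint index sets by construction).
  -- zB i k is meaningful for i ∈ B, zR j ℓ for j ∈ R; other entries are
  -- fixed to 0 by Feasible (so the ambient space is the paper's one padded
  -- with coordinates that are identically zero).
  record Point (m d nB nR : ℕ) : Set c where
    field
      p  : Fin nB → Fin nR → Fin d → Carrier
      q  : Fin nB → Fin nR → Carrier
      zB : Fin m → Fin nB → Carrier
      zR : Fin m → Fin nR → Carrier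

  record Feasible {m d nB nR : ℕ} (X : Fin m → Fin d → Carrier)
                  (B R : Subset m) (M : Carrier) (y : Point m d nB nR)
                  : Set (c ⊔ ℓ₁ ⊔ ℓ₂) where
    open Point y
    field
      zB-bin  : ∀ i k → i ∈ B → IsBinary (zB i k)
      zR-bin  : ∀ j ℓ → j ∈ R → IsBinary (zR j ℓ)
      zB-pad  : ∀ i k → i ∉ B → zB i k ≈ 0#
      zR-pad  : ∀ j ℓ → j ∉ R → zR j ℓ ≈ 0#
      blue    : ∀ i k ℓ → i ∈ B →
                  (p k ℓ · X i) + q k ℓ ≤ M - ((M + 1#) * zB i k)
      red     : ∀ j ℓ k → j ∈ R →
                  (- M) + ((M + 1#) * zR j ℓ) ≤ (p k ℓ · X j) + q k ℓ
      sumB    : ∀ i → i ∈ B → sumF (λ k → zB i k) ≤ 1#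
      sumR    : ∀ j → j ∈ R → sumF (λ ℓ → zR j ℓ) ≤ 1#

  InP : ∀ {m d nB nR : ℕ} (X : Fin m → Fin d → Carrier)
        (B R : Subset m) (M : Carrier) (y : Point m d nB nR) → Set (c ⊔ ℓ₁ ⊔ ℓ₂)
  InP {m} {d} {nB} {nR} X B R M y =
    Σ ℕ λ n → Σ (Fin n → Carrier) λ μ → Σ (Fin n → Point m d nB nR) λ pts →
      (∀ r → Feasible X B R M (pts r)) ×
      (∀ r → 0# ≤ μ r) × (sumF μ ≈ 1#) ×
      (∀ k ℓ t → Point.p y k ℓ t ≈ sumF (λ r → μ r * Point.p (pts r) k ℓ t)) ×
      (∀ k ℓ → Point.q y k ℓ ≈ sumF (λ r → μ r * Point.q (pts r) k ℓ)) ×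
      (∀ i k → Point.zB y i k ≈ sumF (λ r → μ r * Point.zB (pts r) i k)) ×
      (∀ j ℓ → Point.zR y j ℓ ≈ sumF (λ r → μ r * Point.zR (pts r) j ℓ))

  InConvSub : ∀ {m d} → (Fin m → Fin d → Carrier) → Subset m → (Fin d → Carrier) → Set (c ⊔ ℓ₁ ⊔ ℓ₂)
  InConvSub {m} {d} X S v =
    Σ (Fin m → Carrier) λ λ' →
      (∀ i → 0# ≤ λ' i) × (∀ i → i ∉ S → λ' i ≈ 0#) × (sumF λ' ≈ 1#) ×
      (∀ t → v t ≈ sumF (λ i → λ' i * X i t))

  InSegment : ∀ {d} → (Fin d → Carrier) → (Fin d → Carrier) → (Fin d → Carrier) → Set (c ⊔ ℓ₁ ⊔ ℓ₂)
  InSegment y₁ y₂ v = Σ Carrier λ t → (0# ≤ t) × (t ≤ 1#) ×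
      (∀ u → v u ≈ (t * y₁ u) + ((1# - t) * y₂ u))

  IsObstacle : ∀ {m d} → (Fin m → Fin d → Carrier) → Subset m →
               (Fin d → Carrier) → (Fin d → Carrier) → Set (c ⊔ ℓ₁ ⊔ ℓ₂)
  IsObstacle {m} {d} X S y₁ y₂ =
    Σ (Fin d → Carrier) λ v → InConvSub X S v × InSegment y₁ y₂ v

-- For an integer point the inequality can only fail when z_{j₁ℓ} = z_{j₂ℓ} = 1
-- and z_{ik} = 1 for every i ∈ S.  The big-M constraints then make the
-- hyperplane (p_{kℓ}, q_{kℓ}) take values ≤ -1 on x_S and ≥ 1 at x_{j₁}, x_{j₂};
-- being affine, it is ≤ -1 on conv(x_S) and ≥ 1 on the segment, so these are
-- disjoint, contradicting the obstacle hypothesis.  The left-hand side is linear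
-- in (p, q, z), so validity passes from the integer points to their convex hull.
module Submission where

open import Defs
open import Level using (Level; _⊔_)
open import Data.Nat using (ℕ; zero; suc)
open import Data.Fin using (Fin)
open import Data.Bool using (true; false; if_then_else_)
open import Data.Vec using ([]; _∷_; lookup; here; there)
import Data.Vec.Functional as Vector
open import Data.Product using (Σ; _×_; _,_)
open import Data.Sum using (_⊎_; inj₁; inj₂)
open import Data.Empty using (⊥-elim)
open import Data.Fin.Subset using (Subset; _∈_; _⊆_; ∣_∣)
open import Data.Fin.Subset.Properties using (_∈?_)
open import Relation.Nullary using (¬_; yes; no)
open import Relation.Binary.PropositionalEquality using (_≡_)
open import Relation.Binary.Bundles using (Poset)
import Algebra.Properties.Ring as RingProperties
import Algebra.Properties.CommutativeSemigroup as CommutativeSemigroupProperties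
import Relation.Binary.Reasoning.PartialOrder as PosetReasoning

module OrderedFieldProperties {c ℓ₁ ℓ₂ : Level} (F : OrderedField c ℓ₁ ℓ₂) where
  open OrderedField F
  open RingProperties ring using (-‿distribʳ-*; -‿distribˡ-*; -‿involutive)

  poset : Poset c ℓ₁ ℓ₂
  poset = record
    { isPartialOrder = record
      { isPreorder = record
        { isEquivalence = isEquivalence
        ; reflexive     = λ a≈b → ≤-resp-≈ refl a≈b ≤-refl
        ; trans         = ≤-trans
        }
      ; antisym = ≤-antisym
      }
    }

  open PosetReasoning poset public

  ≈⇒≤ : ∀ {a b} → a ≈ b → a ≤ b
  ≈⇒≤ = Poset.reflexive poset

  +-monoʳ-≤ : ∀ {a b} x → a ≤ b → x + a ≤ x + b
  +-monoʳ-≤ x a≤b = ≤-resp-≈ (+-comm _ x) (+-comm _ x) (+-mono-≤ x a≤b)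

  +-mono₂-≤ : ∀ {a b x y} → a ≤ b → x ≤ y → a + x ≤ b + y
  +-mono₂-≤ {b = b} {x} a≤b x≤y = ≤-trans (+-mono-≤ x a≤b) (+-monoʳ-≤ b x≤y)

  x≤y⇒0≤y-x : ∀ {x y} → x ≤ y → 0# ≤ y - x
  x≤y⇒0≤y-x {x} x≤y = ≤-resp-≈ (-‿inverseʳ x) refl (+-mono-≤ (- x) x≤y)

  0≤y-x⇒x≤y : ∀ {x y} → 0# ≤ y - x → x ≤ y
  0≤y-x⇒x≤y {x} {y} 0≤y-x = begin
    x            ≈⟨ +-identityˡ x ⟨
    0# + x       ≤⟨ +-mono-≤ x 0≤y-x ⟩
    (y - x) + x  ≈⟨ +-assoc y (- x) x ⟩
    y + (- x + x) ≈⟨ +-cong refl (-‿inverseˡ x) ⟩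
    y + 0#       ≈⟨ +-identityʳ y ⟩
    y            ∎

  *-monoˡ-≤-nonNeg : ∀ {x a b} → 0# ≤ x → a ≤ b → x * a ≤ x * b
  *-monoˡ-≤-nonNeg {x} {a} {b} 0≤x a≤b = 0≤y-x⇒x≤y (begin
    0#            ≤⟨ *-nonneg 0≤x (x≤y⇒0≤y-x a≤b) ⟩
    x * (b - a)   ≈⟨ distribˡ x b (- a) ⟩
    x * b + x * - a ≈⟨ +-cong refl (-‿distribʳ-* x a) ⟨
    x * b - x * a ∎)

  -- If 1 ≤ 0 then 0 ≤ -1, and 1 = (-1) * (-1) is a product of nonnegatives.
  0≤1 : 0# ≤ 1#
  0≤1 with ≤-total 0# 1#
  ... | inj₁ 0≤1 = 0≤1
  ... | inj₂ 1≤0 = begin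
    0#              ≤⟨ *-nonneg 0≤-1 0≤-1 ⟩
    - 1# * - 1#     ≈⟨ -‿distribˡ-* 1# (- 1#) ⟨
    - (1# * - 1#)   ≈⟨ -‿cong (*-identityˡ (- 1#)) ⟩
    - (- 1#)        ≈⟨ -‿involutive 1# ⟩
    1#              ∎
    where
    0≤-1 : 0# ≤ - 1#
    0≤-1 = ≤-resp-≈ (-‿inverseʳ 1#) (+-identityˡ (- 1#)) (+-mono-≤ (- 1#) 1≤0)

  1≰-1 : ¬ (1# ≤ - 1#)
  1≰-1 1≤-1 = 0≉1 (≤-antisym 0≤1 (≤-trans 1≤-1 -1≤0))
    where
    -1≤0 : - 1# ≤ 0#
    -1≤0 = ≤-resp-≈ (+-identityˡ (- 1#)) (-‿inverseʳ 1#) (+-mono-≤ (- 1#) 0≤1)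

  binary⇒≤1 : ∀ {a} → IsBinary a → a ≤ 1#
  binary⇒≤1 (inj₁ a≈0) = ≤-resp-≈ (sym a≈0) refl 0≤1
  binary⇒≤1 (inj₂ a≈1) = ≈⇒≤ a≈1

  x+[1-x]≈1 : ∀ x → x + (1# - x) ≈ 1#
  x+[1-x]≈1 x = begin-equality
    x + (1# - x)    ≈⟨ +-comm x _ ⟩
    (1# - x) + x    ≈⟨ +-assoc 1# (- x) x ⟩
    1# + (- x + x)  ≈⟨ +-cong refl (-‿inverseˡ x) ⟩
    1# + 0#         ≈⟨ +-identityʳ 1# ⟩
    1#              ∎

  *-swapˡ : ∀ a b x → a * (b * x) ≈ b * (a * x)
  *-swapˡ a b x = begin-equality
    a * (b * x)  ≈⟨ *-assoc a b x ⟨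
    (a * b) * x  ≈⟨ *-cong (*-comm a b) refl ⟩
    (b * a) * x  ≈⟨ *-assoc b a x ⟩
    b * (a * x)  ∎

module FiniteSums {c ℓ₁ ℓ₂ : Level} (F : OrderedField c ℓ₁ ℓ₂) where
  open OrderedField F
  open OrderedFieldProperties F
  open CommutativeSemigroupProperties +-commutativeSemigroup using (interchange)

  sumF-cong : ∀ {n} {f g : Fin n → Carrier} → (∀ i → f i ≈ g i) → sumF f ≈ sumF g
  sumF-cong {zero}  f≈g = refl
  sumF-cong {suc n} f≈g = +-cong (f≈g Fin.zero) (sumF-cong (λ i → f≈g (Fin.suc i)))

  sumF-mono-≤ : ∀ {n} {f g : Fin n → Carrier} → (∀ i → f i ≤ g i) → sumF f ≤ sumF g
  sumF-mono-≤ {zero}  f≤g = ≤-refl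
  sumF-mono-≤ {suc n} f≤g = +-mono₂-≤ (f≤g Fin.zero) (sumF-mono-≤ (λ i → f≤g (Fin.suc i)))

  sumF-zero : ∀ n → sumF {n} (λ _ → 0#) ≈ 0#
  sumF-zero zero    = refl
  sumF-zero (suc n) = trans (+-identityˡ _) (sumF-zero n)

  sumF-+ : ∀ {n} (f g : Fin n → Carrier) → sumF (λ i → f i + g i) ≈ sumF f + sumF g
  sumF-+ {zero}  f g = sym (+-identityʳ 0#)
  sumF-+ {suc n} f g =
    trans (+-cong refl (sumF-+ (λ i → f (Fin.suc i)) (λ i → g (Fin.suc i))))
          (interchange _ _ _ _)

  sumF-*ˡ : ∀ {n} x (f : Fin n → Carrier) → sumF (λ i → x * f i) ≈ x * sumF f
  sumF-*ˡ {zero}  x f = sym (zeroʳ x)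
  sumF-*ˡ {suc n} x f =
    trans (+-cong refl (sumF-*ˡ x (λ i → f (Fin.suc i)))) (sym (distribˡ x _ _))

  sumF-*ʳ : ∀ {n} x (f : Fin n → Carrier) → sumF (λ i → f i * x) ≈ sumF f * x
  sumF-*ʳ x f = trans (sumF-cong (λ i → *-comm (f i) x)) (trans (sumF-*ˡ x f) (*-comm x _))

  sumF-comm : ∀ {n k} (h : Fin n → Fin k → Carrier) →
    sumF (λ i → sumF (λ j → h i j)) ≈ sumF (λ j → sumF (λ i → h i j))
  sumF-comm {zero}  {k} h = sym (sumF-zero k)
  sumF-comm {suc n}     h = begin-equality
    sumF (h Fin.zero) + sumF (λ i → sumF (h (Fin.suc i)))
      ≈⟨ +-cong refl (sumF-comm (λ i → h (Fin.suc i))) ⟩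
    sumF (h Fin.zero) + sumF (λ j → sumF (λ i → h (Fin.suc i) j))
      ≈⟨ sumF-+ (h Fin.zero) (λ j → sumF (λ i → h (Fin.suc i) j)) ⟨
    sumF (λ j → h Fin.zero j + sumF (λ i → h (Fin.suc i) j)) ∎

  sumOver-cong : ∀ {m} (S : Subset m) {f g : Fin m → Carrier} →
    (∀ i → f i ≈ g i) → sumOver S f ≈ sumOver S g
  sumOver-cong S {f} {g} f≈g = sumF-cong restricted
    where
    restricted : ∀ i → (if lookup S i then f i else 0#) ≈ (if lookup S i then g i else 0#)
    restricted i with lookup S i
    ... | true  = f≈g i
    ... | false = refl

  sumOver-sumF-*ˡ : ∀ {m n} (S : Subset m) (μ : Fin n → Carrier) (g : Fin n → Fin m → Carrier) →
    sumOver S (λ i → sumF (λ r → μ r * g r i)) ≈ sumF (λ r → μ r * sumOver S (g r))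
  sumOver-sumF-*ˡ {n = n} S μ g = begin-equality
    sumF (λ i → if lookup S i then sumF (λ r → μ r * g r i) else 0#)
      ≈⟨ sumF-cong restricted ⟩
    sumF (λ i → sumF (λ r → μ r * g|S r i))
      ≈⟨ sumF-comm (λ i r → μ r * g|S r i) ⟩
    sumF (λ r → sumF (λ i → μ r * g|S r i))
      ≈⟨ sumF-cong (λ r → sumF-*ˡ (μ r) (g|S r)) ⟩
    sumF (λ r → μ r * sumOver S (g r)) ∎
    where
    g|S : Fin n → Fin _ → Carrier
    g|S r i = if lookup S i then g r i else 0#
    restricted : ∀ i → (if lookup S i then sumF (λ r → μ r * g r i) else 0#) ≈
                       sumF (λ r → μ r * g|S r i)
    restricted i with lookup S i
    ... | true  = refl
    ... | false = sym (trans (sumF-cong (λ r → zeroʳ (μ r))) (sumF-zero n))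

  sumOver-≤-card : ∀ {m} (S : Subset m) (f : Fin m → Carrier) →
    (∀ i → i ∈ S → f i ≤ 1#) → sumOver S f ≤ fromℕ ∣ S ∣
  sumOver-≤-card []          f f≤1 = ≤-refl
  sumOver-≤-card (true ∷ S)  f f≤1 =
    +-mono₂-≤ (f≤1 Fin.zero here)
              (sumOver-≤-card S (λ i → f (Fin.suc i)) (λ i i∈S → f≤1 (Fin.suc i) (there i∈S)))
  sumOver-≤-card (false ∷ S) f f≤1 =
    ≤-resp-≈ (sym (+-identityˡ _)) refl
             (sumOver-≤-card S (λ i → f (Fin.suc i)) (λ i i∈S → f≤1 (Fin.suc i) (there i∈S)))

  sumOver-binary : ∀ {m} (S : Subset m) (f : Fin m → Carrier) →
    (∀ i → i ∈ S → IsBinary (f i)) →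
    (sumOver S f + 1# ≤ fromℕ ∣ S ∣) ⊎ (∀ i → i ∈ S → f i ≈ 1#)
  sumOver-binary []          f bin = inj₂ (λ _ ())
  sumOver-binary (false ∷ S) f bin
    with sumOver-binary S (λ i → f (Fin.suc i)) (λ i i∈S → bin (Fin.suc i) (there i∈S))
  ... | inj₁ short = inj₁ (≤-resp-≈ (+-cong (sym (+-identityˡ _)) refl) refl short)
  ... | inj₂ ones  = inj₂ λ { (Fin.suc i) (there i∈S) → ones i i∈S }
  sumOver-binary (true ∷ S)  f bin with bin Fin.zero here
  ... | inj₁ f₀≈0 = inj₁ (begin
    (f Fin.zero + rest) + 1#  ≈⟨ +-cong (+-cong f₀≈0 refl) refl ⟩
    (0# + rest) + 1#          ≈⟨ +-cong (+-identityˡ rest) refl ⟩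
    rest + 1#                 ≈⟨ +-comm rest 1# ⟩
    1# + rest                 ≤⟨ +-monoʳ-≤ 1# (sumOver-≤-card S _ (λ i i∈S → binary⇒≤1 (bin (Fin.suc i) (there i∈S)))) ⟩
    1# + fromℕ ∣ S ∣          ∎)
    where
    rest : Carrier
    rest = sumOver S (λ i → f (Fin.suc i))
  ... | inj₂ f₀≈1
    with sumOver-binary S (λ i → f (Fin.suc i)) (λ i i∈S → bin (Fin.suc i) (there i∈S))
  ... | inj₁ short = inj₁ (≤-resp-≈ (sym (+-assoc _ _ _)) refl (+-mono₂-≤ (≈⇒≤ f₀≈1) short))
  ... | inj₂ ones  = inj₂ λ { Fin.zero here → f₀≈1 ; (Fin.suc i) (there i∈S) → ones i i∈S }

module Convexity {c ℓ₁ ℓ₂ : Level} (F : OrderedField c ℓ₁ ℓ₂) where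
  open OrderedField F
  open OrderedFieldProperties F
  open FiniteSums F

  ConvexWeights : ∀ {n} → (Fin n → Carrier) → Set (ℓ₁ ⊔ ℓ₂)
  ConvexWeights w = (∀ i → 0# ≤ w i) × (sumF w ≈ 1#)

  sumF-weighted-const : ∀ {n} (w : Fin n → Carrier) → sumF w ≈ 1# →
    ∀ a → sumF (λ i → w i * a) ≈ a
  sumF-weighted-const w Σw≈1 a = begin-equality
    sumF (λ i → w i * a)  ≈⟨ sumF-*ʳ a w ⟩
    sumF w * a            ≈⟨ *-cong Σw≈1 refl ⟩
    1# * a                ≈⟨ *-identityˡ a ⟩
    a                     ∎

  convex-≤ : ∀ {n} (w : Fin n → Carrier) {f : Fin n → Carrier} {a} → ConvexWeights w →
    (∀ i → (w i ≈ 0#) ⊎ (f i ≤ a)) → sumF (λ i → w i * f i) ≤ a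
  convex-≤ w {f} {a} (0≤w , Σw≈1) bounded = begin
    sumF (λ i → w i * f i)  ≤⟨ sumF-mono-≤ pointwise ⟩
    sumF (λ i → w i * a)    ≈⟨ sumF-weighted-const w Σw≈1 a ⟩
    a                       ∎
    where
    pointwise : ∀ i → w i * f i ≤ w i * a
    pointwise i with bounded i
    ... | inj₂ fᵢ≤a = *-monoˡ-≤-nonNeg (0≤w i) fᵢ≤a
    ... | inj₁ wᵢ≈0 = ≈⇒≤ (begin-equality
      w i * f i  ≈⟨ *-cong wᵢ≈0 refl ⟩
      0# * f i   ≈⟨ zeroˡ (f i) ⟩
      0#         ≈⟨ zeroˡ a ⟨
      0# * a     ≈⟨ *-cong wᵢ≈0 refl ⟨
      w i * a    ∎)

  convex-≥ : ∀ {n} (w : Fin n → Carrier) {f : Fin n → Carrier} {a} → ConvexWeights w →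
    (∀ i → a ≤ f i) → a ≤ sumF (λ i → w i * f i)
  convex-≥ w {f} {a} (0≤w , Σw≈1) bounded = begin
    a                       ≈⟨ sumF-weighted-const w Σw≈1 a ⟨
    sumF (λ i → w i * a)    ≤⟨ sumF-mono-≤ (λ i → *-monoˡ-≤-nonNeg (0≤w i) (bounded i)) ⟩
    sumF (λ i → w i * f i)  ∎

  ·-combination : ∀ {n d} (w : Fin n → Carrier) (Y : Fin n → Fin d → Carrier)
    (p v : Fin d → Carrier) → (∀ u → v u ≈ sumF (λ i → w i * Y i u)) →
    p · v ≈ sumF (λ i → w i * (p · Y i))
  ·-combination w Y p v v≈ΣwY = begin-equality
    sumF (λ u → p u * v u)
      ≈⟨ sumF-cong (λ u → *-cong refl (v≈ΣwY u)) ⟩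
    sumF (λ u → p u * sumF (λ i → w i * Y i u))
      ≈⟨ sumF-cong (λ u → sumF-*ˡ (p u) (λ i → w i * Y i u)) ⟨
    sumF (λ u → sumF (λ i → p u * (w i * Y i u)))
      ≈⟨ sumF-cong (λ u → sumF-cong (λ i → *-swapˡ (p u) (w i) (Y i u))) ⟩
    sumF (λ u → sumF (λ i → w i * (p u * Y i u)))
      ≈⟨ sumF-comm (λ u i → w i * (p u * Y i u)) ⟩
    sumF (λ i → sumF (λ u → w i * (p u * Y i u)))
      ≈⟨ sumF-cong (λ i → sumF-*ˡ (w i) (λ u → p u * Y i u)) ⟩
    sumF (λ i → w i * (p · Y i)) ∎

  affine-combination : ∀ {n d} (w : Fin n → Carrier) (Y : Fin n → Fin d → Carrier)
    (p v : Fin d → Carrier) (q : Carrier) → sumF w ≈ 1# →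
    (∀ u → v u ≈ sumF (λ i → w i * Y i u)) →
    (p · v) + q ≈ sumF (λ i → w i * ((p · Y i) + q))
  affine-combination w Y p v q Σw≈1 v≈ΣwY = begin-equality
    (p · v) + q
      ≈⟨ +-cong (·-combination w Y p v v≈ΣwY) (sym (sumF-weighted-const w Σw≈1 q)) ⟩
    sumF (λ i → w i * (p · Y i)) + sumF (λ i → w i * q)
      ≈⟨ sumF-+ (λ i → w i * (p · Y i)) (λ i → w i * q) ⟨
    sumF (λ i → w i * (p · Y i) + w i * q)
      ≈⟨ sumF-cong (λ i → distribˡ (w i) (p · Y i) q) ⟨
    sumF (λ i → w i * ((p · Y i) + q)) ∎

  segment⇒combination : ∀ {d} {y₁ y₂ v : Fin d → Carrier} → InSegment y₁ y₂ v →
    Σ (Fin 2 → Carrier) λ w → ConvexWeights w ×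
      (∀ u → v u ≈ sumF (λ i → w i * (y₁ Vector.∷ y₂ Vector.∷ Vector.[]) i u))
  segment⇒combination {y₁ = y₁} {y₂} {v} (t , 0≤t , t≤1 , v≈) =
    (t Vector.∷ (1# - t) Vector.∷ Vector.[]) ,
    ((λ { Fin.zero → 0≤t ; (Fin.suc Fin.zero) → x≤y⇒0≤y-x t≤1 }) ,
     trans (+-cong refl (+-identityʳ (1# - t))) (x+[1-x]≈1 t)) ,
    (λ u → trans (v≈ u) (+-cong refl (sym (+-identityʳ _))))

  separated⇒¬IsObstacle : ∀ {m d} (X : Fin m → Fin d → Carrier) (S : Subset m)
    {y₁ y₂ : Fin d → Carrier} (p : Fin d → Carrier) (q : Carrier) {a b : Carrier} →
    ¬ (b ≤ a) → (∀ i → i ∈ S → (p · X i) + q ≤ a) →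
    b ≤ (p · y₁) + q → b ≤ (p · y₂) + q → ¬ IsObstacle X S y₁ y₂
  separated⇒¬IsObstacle X S {y₁} {y₂} p q {a} {b} b≰a below above₁ above₂
    (v , (w , 0≤w , w-outside , Σw≈1 , v≈ΣwX) , segment)
    with segment⇒combination segment
  ... | w′ , convex′@(_ , Σw′≈1) , v≈Σw′Y = b≰a (begin
    b                                      ≤⟨ convex-≥ w′ convex′ above ⟩
    sumF (λ i → w′ i * ((p · Y i) + q))    ≈⟨ affine-combination w′ Y p v q Σw′≈1 v≈Σw′Y ⟨
    (p · v) + q                            ≈⟨ affine-combination w X p v q Σw≈1 v≈ΣwX ⟩
    sumF (λ i → w i * ((p · X i) + q))     ≤⟨ convex-≤ w (0≤w , Σw≈1) bounded-on-support ⟩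
    a                                      ∎)
    where
    Y : Fin 2 → Fin _ → Carrier
    Y = y₁ Vector.∷ y₂ Vector.∷ Vector.[]
    above : ∀ i → b ≤ (p · Y i) + q
    above Fin.zero           = above₁
    above (Fin.suc Fin.zero) = above₂
    bounded-on-support : ∀ i → (w i ≈ 0#) ⊎ ((p · X i) + q ≤ a)
    bounded-on-support i with i ∈? S
    ... | yes i∈S = inj₂ (below i i∈S)
    ... | no  i∉S = inj₁ (w-outside i i∉S)

module ObstacleInequality {c ℓ₁ ℓ₂ : Level} (F : OrderedField c ℓ₁ ℓ₂) where
  open OrderedField F
  open OrderedFieldProperties F
  open FiniteSums F
  open Convexity F
  open RingProperties ring using (-‿+-comm)

  obstacleLHS : ∀ {m d nB nR} → Subset m → (j₁ j₂ : Fin m) → Fin nB → Fin nR →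
    Point m d nB nR → Carrier
  obstacleLHS S j₁ j₂ k ℓ y =
    (Point.zR y j₁ ℓ + Point.zR y j₂ ℓ) + sumOver S (λ i → Point.zB y i k)

  obstacleLHS-combination : ∀ {m d nB nR n} (S : Subset m) (j₁ j₂ : Fin m) (k : Fin nB)
    (ℓ : Fin nR) (y : Point m d nB nR) (μ : Fin n → Carrier) (pts : Fin n → Point m d nB nR) →
    (∀ i k → Point.zB y i k ≈ sumF (λ r → μ r * Point.zB (pts r) i k)) →
    (∀ j ℓ → Point.zR y j ℓ ≈ sumF (λ r → μ r * Point.zR (pts r) j ℓ)) →
    obstacleLHS S j₁ j₂ k ℓ y ≈ sumF (λ r → μ r * obstacleLHS S j₁ j₂ k ℓ (pts r))
  obstacleLHS-combination S j₁ j₂ k ℓ y μ pts zB≈ zR≈ = begin-equality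
    (Point.zR y j₁ ℓ + Point.zR y j₂ ℓ) + sumOver S (λ i → Point.zB y i k)
      ≈⟨ +-cong (+-cong (zR≈ j₁ ℓ) (zR≈ j₂ ℓ))
                (trans (sumOver-cong S (λ i → zB≈ i k)) (sumOver-sumF-*ˡ S μ zB)) ⟩
    (sumF (λ r → μ r * a r) + sumF (λ r → μ r * b r)) + sumF (λ r → μ r * σ r)
      ≈⟨ +-cong (sumF-+ (λ r → μ r * a r) (λ r → μ r * b r)) refl ⟨
    sumF (λ r → μ r * a r + μ r * b r) + sumF (λ r → μ r * σ r)
      ≈⟨ sumF-+ (λ r → μ r * a r + μ r * b r) (λ r → μ r * σ r) ⟨
    sumF (λ r → (μ r * a r + μ r * b r) + μ r * σ r)
      ≈⟨ sumF-cong (λ r → trans (distribˡ (μ r) (a r + b r) (σ r))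
                                (+-cong (distribˡ (μ r) (a r) (b r)) refl)) ⟨
    sumF (λ r → μ r * ((a r + b r) + σ r)) ∎
    where
    zB : Fin _ → Fin _ → Carrier
    zB r i = Point.zB (pts r) i k
    a b σ : Fin _ → Carrier
    a r = Point.zR (pts r) j₁ ℓ
    b r = Point.zR (pts r) j₂ ℓ
    σ r = sumOver S (zB r)

  bigM-active-blue : ∀ M → M - (M + 1#) * 1# ≈ - 1#
  bigM-active-blue M = begin-equality
    M - (M + 1#) * 1#   ≈⟨ +-cong refl (-‿cong (*-identityʳ _)) ⟩
    M - (M + 1#)        ≈⟨ +-cong refl (-‿+-comm M 1#) ⟨
    M + (- M + - 1#)    ≈⟨ +-assoc M (- M) (- 1#) ⟨
    (M - M) + - 1#      ≈⟨ +-cong (-‿inverseʳ M) refl ⟩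
    0# + - 1#           ≈⟨ +-identityˡ _ ⟩
    - 1#                ∎

  bigM-active-red : ∀ M → - M + (M + 1#) * 1# ≈ 1#
  bigM-active-red M = begin-equality
    - M + (M + 1#) * 1#  ≈⟨ +-cong refl (*-identityʳ _) ⟩
    - M + (M + 1#)       ≈⟨ +-assoc (- M) M 1# ⟨
    (- M + M) + 1#       ≈⟨ +-cong (-‿inverseˡ M) refl ⟩
    0# + 1#              ≈⟨ +-identityˡ 1# ⟩
    1#                   ∎

  binary-pair-bound : ∀ {a b σ s} → IsBinary a → IsBinary b → σ ≤ s →
    (a ≈ 1# → b ≈ 1# → σ + 1# ≤ s) → (a + b) + σ ≤ s + 1#
  binary-pair-bound {a} {b} {σ} {s} (inj₁ a≈0) b-binary σ≤s _ = begin
    (a + b) + σ    ≤⟨ +-mono₂-≤ (+-mono₂-≤ (≈⇒≤ a≈0) (binary⇒≤1 b-binary)) σ≤s ⟩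
    (0# + 1#) + s  ≈⟨ +-cong (+-identityˡ 1#) refl ⟩
    1# + s         ≈⟨ +-comm 1# s ⟩
    s + 1#         ∎
  binary-pair-bound {a} {b} {σ} {s} (inj₂ a≈1) (inj₁ b≈0) σ≤s _ = begin
    (a + b) + σ    ≤⟨ +-mono₂-≤ (+-mono₂-≤ (≈⇒≤ a≈1) (≈⇒≤ b≈0)) σ≤s ⟩
    (1# + 0#) + s  ≈⟨ +-cong (+-identityʳ 1#) refl ⟩
    1# + s         ≈⟨ +-comm 1# s ⟩
    s + 1#         ∎
  binary-pair-bound {a} {b} {σ} {s} (inj₂ a≈1) (inj₂ b≈1) _ both-one = begin
    (a + b) + σ    ≈⟨ +-cong (+-cong a≈1 b≈1) refl ⟩
    (1# + 1#) + σ  ≈⟨ +-comm _ σ ⟩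
    σ + (1# + 1#)  ≈⟨ +-assoc σ 1# 1# ⟨
    (σ + 1#) + 1#  ≤⟨ +-mono-≤ 1# (both-one a≈1 b≈1) ⟩
    s + 1#         ∎

  feasible⇒obstacleInequality : ∀ {m d nB nR} {X : Fin m → Fin d → Carrier} {B R : Subset m}
    {M : Carrier} {y : Point m d nB nR} → Feasible X B R M y →
    (S : Subset m) → S ⊆ B → (j₁ j₂ : Fin m) → j₁ ∈ R → j₂ ∈ R →
    IsObstacle X S (X j₁) (X j₂) → ∀ k ℓ → obstacleLHS S j₁ j₂ k ℓ y ≤ fromℕ ∣ S ∣ + 1#
  feasible⇒obstacleInequality {X = X} {R = R} {M = M} {y = y} feasible S S⊆B j₁ j₂ j₁∈R j₂∈R obstacle k ℓ =
    binary-pair-bound (zR-bin j₁ ℓ j₁∈R) (zR-bin j₂ ℓ j₂∈R)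
      (sumOver-≤-card S _ (λ i i∈S → binary⇒≤1 (S-binary i i∈S))) both-red-assigned
    where
    open Point y
    open Feasible feasible

    S-binary : ∀ i → i ∈ S → IsBinary (zB i k)
    S-binary i i∈S = zB-bin i k (S⊆B i∈S)

    red-above : ∀ {j} → j ∈ R → zR j ℓ ≈ 1# → 1# ≤ (p k ℓ · X j) + q k ℓ
    red-above {j} j∈R zⱼ≈1 = begin
      1#                          ≈⟨ bigM-active-red M ⟨
      - M + (M + 1#) * 1#         ≈⟨ +-cong refl (*-cong refl zⱼ≈1) ⟨
      - M + (M + 1#) * zR j ℓ     ≤⟨ red j ℓ k j∈R ⟩
      (p k ℓ · X j) + q k ℓ       ∎

    both-red-assigned : zR j₁ ℓ ≈ 1# → zR j₂ ℓ ≈ 1# → sumOver S (λ i → zB i k) + 1# ≤ fromℕ ∣ S ∣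
    both-red-assigned z₁≈1 z₂≈1 with sumOver-binary S (λ i → zB i k) S-binary
    ... | inj₁ short       = short
    ... | inj₂ all-assigned = ⊥-elim
      (separated⇒¬IsObstacle X S (p k ℓ) (q k ℓ) 1≰-1 blue-below
        (red-above j₁∈R z₁≈1) (red-above j₂∈R z₂≈1) obstacle)
      where
      blue-below : ∀ i → i ∈ S → (p k ℓ · X i) + q k ℓ ≤ - 1#
      blue-below i i∈S = begin
        (p k ℓ · X i) + q k ℓ     ≤⟨ blue i k ℓ (S⊆B i∈S) ⟩
        M - (M + 1#) * zB i k     ≈⟨ +-cong refl (-‿cong (*-cong refl (all-assigned i i∈S))) ⟩
        M - (M + 1#) * 1#         ≈⟨ bigM-active-blue M ⟩
        - 1#                      ∎

proposition4 : ∀ {c ℓ₁ ℓ₂ : Level} (F : OrderedField c ℓ₁ ℓ₂) →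
    let open OrderedField F in
    (m d nB nR : ℕ) (X : Fin m → Fin d → Carrier) (B R : Subset m) →
    (∀ i → (i ∈ B) ⊎ (i ∈ R)) → (∀ i → i ∈ B → ¬ (i ∈ R)) →
    (M : Carrier) → 0# < M →
    (S : Subset m) → S ⊆ B →
    (j₁ j₂ : Fin m) → j₁ ∈ R → j₂ ∈ R → ¬ (j₁ ≡ j₂) →
    IsObstacle X S (X j₁) (X j₂) →
    (k : Fin nB) (ℓ : Fin nR) (y : Point m d nB nR) → InP X B R M y →
    (Point.zR y j₁ ℓ + Point.zR y j₂ ℓ) + sumOver S (λ i → Point.zB y i k)
    ≤ fromℕ ∣ S ∣ + 1#
proposition4 F m d nB nR X B R _ _ M _ S S⊆B j₁ j₂ j₁∈R j₂∈R _ obstacle k ℓ y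
  (n , μ , pts , feasible , 0≤μ , Σμ≈1 , _ , _ , zB≈ , zR≈) = begin
    obstacleLHS S j₁ j₂ k ℓ y
      ≈⟨ obstacleLHS-combination S j₁ j₂ k ℓ y μ pts zB≈ zR≈ ⟩
    sumF (λ r → μ r * obstacleLHS S j₁ j₂ k ℓ (pts r))
      ≤⟨ convex-≤ μ (0≤μ , Σμ≈1) (λ r → inj₂ (valid-at-vertex r)) ⟩
    fromℕ ∣ S ∣ + 1# ∎
  where
  open OrderedField F
  open OrderedFieldProperties F
  open Convexity F
  open ObstacleInequality F

  valid-at-vertex : ∀ r → obstacleLHS S j₁ j₂ k ℓ (pts r) ≤ fromℕ ∣ S ∣ + 1#
  valid-at-vertex r =
    feasible⇒obstacleInequality (feasible r) S S⊆B j₁ j₂ j₁∈R j₂∈R obstacle k ℓ
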